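{- Let $G$ and $H$ be finite simple graphs such that neither has an isolatable vertex. If $G\,\square\, H$ is well-covered, then: (i) for each of $X\in\{G,H\}$, for every maximal independent set $M$ of $X$ there exists a maximal independent set $N$ of $X$ with $N\cap M=\emptyset$; and (ii) at least one of $G$ or $H$ has the property that any two disjoint maximal independent sets of it have the same cardinality.
   Context: A graph is well-covered if every maximal independent set of vertices has the same cardinality. A vertex $x$ of a graph $X$ is isolatable if there is an independent set $M$ of $X$ such that $X-N[M]$ consists of the single vertex $x$, where $N[M]$ is the closed neighborhood of $M$. The Cartesian product $G\,\square\, H$ has vertex set $V(G)\times V(H)$, with $(x_1,x_2)$ adjacent to $(y_1,y_2)$ if either $x_1=y_1$ and $x_2y_2\in E(H)$, or $x_1y_1\in E(G)$ and $x_2=y_2$. -}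

module Defs where

open import Data.Nat using (ℕ; _*_)
open import Data.Fin using (Fin; remQuot)
open import Data.Fin.Subset using (Subset; _∈_; _∉_; _⊆_; _∩_; ∣_∣; Empty)
open import Data.Product using (Σ; _×_; _,_; proj₁; proj₂; ∃)
open import Data.Sum using (_⊎_)
open import Relation.Nullary using (¬_; Dec)
open import Relation.Binary.PropositionalEquality using (_≡_)
open import Function.Bundles using (_⇔_)

record Graph (n : ℕ) : Set₁ where
  field
    Adj     : Fin n → Fin n → Set
    adj?    : ∀ x y → Dec (Adj x y)
    symm    : ∀ {x y} → Adj x y → Adj y x
    irrefl  : ∀ {x} → ¬ Adj x x
open Graph public

module _ {n : ℕ} (G : Graph n) where

  Independent : Subset n → Set
  Independent S = ∀ {x y} → x ∈ S → y ∈ S → ¬ Adj G x y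

  MaximalIndependent : Subset n → Set
  MaximalIndependent S =
    Independent S × (∀ T → Independent T → S ⊆ T → T ⊆ S)

  WellCovered : Set
  WellCovered = ∀ S T → MaximalIndependent S → MaximalIndependent T → ∣ S ∣ ≡ ∣ T ∣

  InClosedNbhd : Subset n → Fin n → Set
  InClosedNbhd M y = y ∈ M ⊎ Σ (Fin n) (λ z → z ∈ M × Adj G z y)

  Isolatable : Fin n → Set
  Isolatable x = Σ (Subset n) λ M →
    Independent M × (∀ y → (¬ InClosedNbhd M y) ⇔ (y ≡ x))

  HasIsolatableVertex : Set
  HasIsolatableVertex = Σ (Fin n) Isolatable

  DisjointMISProperty : Set
  DisjointMISProperty = ∀ M → MaximalIndependent M →
    Σ (Subset n) λ N → MaximalIndependent N × Empty (N ∩ M)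

  DisjointMISEqualSize : Set
  DisjointMISEqualSize = ∀ M N → MaximalIndependent M → MaximalIndependent N →
    Empty (M ∩ N) → ∣ M ∣ ≡ ∣ N ∣

_□_ : {m n : ℕ} → Graph m → Graph n → Graph (m * n)
_□_ {m} {n} G H = record
  { Adj    = λ i j → A (remQuot n i) (remQuot n j)
  ; adj?   = λ i j → A? (remQuot n i) (remQuot n j)
  ; symm   = λ {i} {j} → As (remQuot n i) (remQuot n j)
  ; irrefl = λ {i} → Ai (remQuot n i)
  }
  where
  open import Data.Fin using (_≟_)
  open import Relation.Nullary using (yes; no)
  open import Data.Sum using (inj₁; inj₂)
  open import Relation.Binary.PropositionalEquality using (sym)
  A : Fin m × Fin n → Fin m × Fin n → Set
  A (x₁ , x₂) (y₁ , y₂) = (x₁ ≡ y₁ × Adj H x₂ y₂) ⊎ (Adj G x₁ y₁ × x₂ ≡ y₂)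
  A? : ∀ p q → Dec (A p q)
  A? (x₁ , x₂) (y₁ , y₂) with x₁ ≟ y₁ | adj? H x₂ y₂ | adj? G x₁ y₁ | x₂ ≟ y₂
  ... | yes e | yes a | _ | _ = yes (inj₁ (e , a))
  ... | _ | _ | yes a | yes e = yes (inj₂ (a , e))
  ... | no e | _ | no a | _ = no λ { (inj₁ (e' , _)) → e e' ; (inj₂ (a' , _)) → a a' }
  ... | no e | _ | yes _ | no f = no λ { (inj₁ (e' , _)) → e e' ; (inj₂ (_ , f')) → f f' }
  ... | yes _ | no b | no a | _ = no λ { (inj₁ (_ , b')) → b b' ; (inj₂ (a' , _)) → a a' }
  ... | yes _ | no b | yes _ | no f = no λ { (inj₁ (_ , b')) → b b' ; (inj₂ (_ , f')) → f f' }
  As : ∀ p q → A p q → A q p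
  As _ _ (inj₁ (e , a)) = inj₁ (sym e , symm H a)
  As _ _ (inj₂ (a , e)) = inj₂ (symm G a , sym e)
  Ai : ∀ p → ¬ A p p
  Ai _ (inj₁ (_ , a)) = irrefl H a
  Ai _ (inj₂ (a , _)) = irrefl G a

module Submission where

-- (i) needs only that X has no isolatable vertex.  Given a maximal independent set M of X,
-- greedily grow a maximal independent set N of X − M.  If N dominates X it is the required
-- partner of M; if it misses some u ∈ M, then N together with the other vertices of M that N
-- does not dominate is independent and dominates everything except u, so u is isolatable.
--
-- (ii) rests on an exchange lemma: in a well-covered graph, two independent sets S₁, S₂ that
-- dominate every vertex outside a region R and neither meet nor touch R have equal size
-- (extend S₁ to a maximal independent set S₁ ∪ T with T ⊆ R; then S₂ ∪ T is maximal as well).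
-- For disjoint maximal independent sets A, B of G and C, D of H, the diagonal sets
-- (A × C) ∪ (B × D) and (A × D) ∪ (B × C) of G □ H surround the vertices outside A ∪ B and
-- C ∪ D in both coordinates, giving ∣A∣∣C∣ + ∣B∣∣D∣ = ∣A∣∣D∣ + ∣B∣∣C∣, so ∣A∣ = ∣B∣ or ∣C∣ = ∣D∣.

open import Defs
open import Algebra.Properties.CommutativeSemigroup using (interchange)
open import Data.Nat using (ℕ; zero; suc; _+_; _*_)
open import Data.Nat.Properties
  using (+-suc; +-comm; +-identityʳ; +-cancelˡ-≡; +-cancelʳ-≡; *-cancelˡ-≡; +-commutativeSemigroup)
  renaming (_≟_ to _≟ℕ_)
open import Data.Fin using (Fin; zero; suc; _↑ˡ_; _↑ʳ_; combine; remQuot; quotient; remainder; _≟_)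
open import Data.Fin.Properties using (any?; all?; combine-remQuot; remQuot-combine)
open import Data.Fin.Subset
  using (Subset; inside; outside; _∈_; _∉_; _⊆_; _∪_; _∩_; ∁; ⁅_⁆; ⊤; ∣_∣; Empty)
  renaming (⊥ to ∅)
open import Data.Fin.Subset.Properties
  using ( _∈?_; ∉⊥; ∈⊤; ∣⊥∣≡0; x∈p∩q⁺; x∈p∩q⁻; x∈p∪q⁻; p⊆p∪q; q⊆p∪q; ∪-comm
        ; x∈∁p⇒x∉p; x∉p⇒x∈∁p; x∈⁅x⁆; x∈⁅y⁆⇒x≡y; ⊆-antisym; p∩q⊆p; p∩q⊆q; nonempty?; anySubset?)
open import Data.List using (List; []; _∷_; allFin)
open import Data.List.Membership.Propositional using () renaming (_∈_ to _∈ₗ_)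
open import Data.List.Membership.Propositional.Properties using (∈-allFin)
open import Data.List.Relation.Unary.Any using (here; there)
open import Data.Vec using ([]; _∷_; _++_; tabulate)
open import Data.Vec.Properties using (lookup∘tabulate; []=⇒lookup; lookup⇒[]=)
open import Data.Product using (_×_; _,_; proj₁; proj₂; ∃; ∃₂; map₁)
open import Data.Sum using (_⊎_; inj₁; inj₂; [_,_]′)
open import Data.Empty using (⊥-elim) renaming (⊥ to Never)
open import Function.Bundles using (mk⇔)
open import Relation.Nullary using (¬_; Dec; yes; no; does)
open import Relation.Nullary.Decidable
  using (_×-dec_; _⊎-dec_; _→-dec_; ¬?; map′; decidable-stable)
open import Relation.Unary using (Decidable)
open import Relation.Binary.PropositionalEquality
  using (_≡_; _≢_; refl; sym; trans; cong; cong₂; subst; module ≡-Reasoning)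
import Data.Vec.Base as Vec
import Data.Sum as Sum

open Vec._[_]=_
open ≡-Reasoning

-- Finite subsets of Fin k

module _ {k : ℕ} where

  Disjoint : Subset k → Subset k → Set
  Disjoint p q = ∀ {x} → x ∈ p → x ∈ q → Never

  Empty∩⇒Disjoint : ∀ {p q : Subset k} → Empty (p ∩ q) → Disjoint p q
  Empty∩⇒Disjoint empty x∈p x∈q = empty (_ , x∈p∩q⁺ (x∈p , x∈q))

  Disjoint⇒Empty∩ : ∀ {p q : Subset k} → Disjoint p q → Empty (p ∩ q)
  Disjoint⇒Empty∩ {p} {q} disjoint (_ , x∈p∩q) =
    disjoint (proj₁ (x∈p∩q⁻ p q x∈p∩q)) (proj₂ (x∈p∩q⁻ p q x∈p∩q))

  ∪-disjoint : ∀ {S S′ T : Subset k} → Disjoint S T → Disjoint S′ T → Disjoint (S ∪ S′) T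
  ∪-disjoint {S} {S′} d d′ x∈ x∈T =
    [ (λ x∈S → d x∈S x∈T) , (λ x∈S′ → d′ x∈S′ x∈T) ]′ (x∈p∪q⁻ S S′ x∈)

  disjoint-∁∪ˡ : ∀ (p q : Subset k) → Disjoint p (∁ (p ∪ q))
  disjoint-∁∪ˡ p q x∈p x∈∁ = x∈∁p⇒x∉p x∈∁ (p⊆p∪q q x∈p)

  disjoint-∁∪ʳ : ∀ (p q : Subset k) → Disjoint q (∁ (p ∪ q))
  disjoint-∁∪ʳ p q x∈q x∈∁ = x∈∁p⇒x∉p x∈∁ (q⊆p∪q p q x∈q)

  ∉∪⇒∈∁∪ : ∀ {p q : Subset k} {x} → x ∉ p → x ∉ q → x ∈ ∁ (p ∪ q)
  ∉∪⇒∈∁∪ {p} {q} x∉p x∉q = x∉p⇒x∈∁p (λ x∈ → [ x∉p , x∉q ]′ (x∈p∪q⁻ p q x∈))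

  ⟦_⟧ : ∀ {P : Fin k → Set} → Decidable P → Subset k
  ⟦ P? ⟧ = tabulate (λ x → does (P? x))

  ∈⟦⟧⁺ : ∀ {P : Fin k → Set} (P? : Decidable P) {x} → P x → x ∈ ⟦ P? ⟧
  ∈⟦⟧⁺ P? {x} px with P? x in eq
  ... | yes _ = lookup⇒[]= x ⟦ P? ⟧ (trans (lookup∘tabulate (λ y → does (P? y)) x) (cong does eq))
  ... | no ¬px = ⊥-elim (¬px px)

  ∈⟦⟧⁻ : ∀ {P : Fin k → Set} (P? : Decidable P) {x} → x ∈ ⟦ P? ⟧ → P x
  ∈⟦⟧⁻ P? {x} x∈ with P? x | trans (sym (lookup∘tabulate (λ y → does (P? y)) x)) ([]=⇒lookup x∈)
  ... | yes px | _  = px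
  ... | no _   | ()

∣p∪q∣≡∣p∣+∣q∣ : ∀ {k} (p q : Subset k) → Disjoint p q → ∣ p ∪ q ∣ ≡ ∣ p ∣ + ∣ q ∣
∣p∪q∣≡∣p∣+∣q∣ []            []            _ = refl
∣p∪q∣≡∣p∣+∣q∣ (inside  ∷ p) (inside  ∷ q) d = ⊥-elim (d here here)
∣p∪q∣≡∣p∣+∣q∣ (inside  ∷ p) (outside ∷ q) d =
  cong suc (∣p∪q∣≡∣p∣+∣q∣ p q (λ a b → d (there a) (there b)))
∣p∪q∣≡∣p∣+∣q∣ (outside ∷ p) (inside  ∷ q) d =
  trans (cong suc (∣p∪q∣≡∣p∣+∣q∣ p q (λ a b → d (there a) (there b)))) (sym (+-suc ∣ p ∣ ∣ q ∣))
∣p∪q∣≡∣p∣+∣q∣ (outside ∷ p) (outside ∷ q) d = ∣p∪q∣≡∣p∣+∣q∣ p q (λ a b → d (there a) (there b))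

∣p++q∣≡∣p∣+∣q∣ : ∀ {m n} (p : Subset m) (q : Subset n) → ∣ p ++ q ∣ ≡ ∣ p ∣ + ∣ q ∣
∣p++q∣≡∣p∣+∣q∣ []            q = refl
∣p++q∣≡∣p∣+∣q∣ (inside  ∷ p) q = cong suc (∣p++q∣≡∣p∣+∣q∣ p q)
∣p++q∣≡∣p∣+∣q∣ (outside ∷ p) q = ∣p++q∣≡∣p∣+∣q∣ p q

∈-++⁺ˡ : ∀ {m n} {p : Subset m} {q : Subset n} {i} → i ∈ p → i ↑ˡ n ∈ p ++ q
∈-++⁺ˡ here        = here
∈-++⁺ˡ (there i∈p) = there (∈-++⁺ˡ i∈p)

∈-++⁻ˡ : ∀ {m n} (p : Subset m) {q : Subset n} {i} → i ↑ˡ n ∈ p ++ q → i ∈ p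
∈-++⁻ˡ (inside ∷ p) {i = zero}  here      = here
∈-++⁻ˡ (_      ∷ p) {i = suc i} (there e) = there (∈-++⁻ˡ p e)

∈-++⁺ʳ : ∀ {m n} (p : Subset m) {q : Subset n} {j} → j ∈ q → m ↑ʳ j ∈ p ++ q
∈-++⁺ʳ []      j∈q = j∈q
∈-++⁺ʳ (_ ∷ p) j∈q = there (∈-++⁺ʳ p j∈q)

∈-++⁻ʳ : ∀ {m n} (p : Subset m) {q : Subset n} {j} → m ↑ʳ j ∈ p ++ q → j ∈ q
∈-++⁻ʳ []      e         = e
∈-++⁻ʳ (_ ∷ p) (there e) = ∈-++⁻ʳ p e

-- The product X ⊠ Y ⊆ Fin (m * n) of subsets, laid out in the block order of `combine`:
-- the vertex `combine a c` belongs to X ⊠ Y exactly when a ∈ X and c ∈ Y.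
_⊠_ : ∀ {m n} → Subset m → Subset n → Subset (m * n)
[]            ⊠ Y = []
(outside ∷ X) ⊠ Y = ∅ {_} ++ X ⊠ Y
(inside  ∷ X) ⊠ Y = Y ++ X ⊠ Y

∣X⊠Y∣≡∣X∣*∣Y∣ : ∀ {m n} (X : Subset m) (Y : Subset n) → ∣ X ⊠ Y ∣ ≡ ∣ X ∣ * ∣ Y ∣
∣X⊠Y∣≡∣X∣*∣Y∣ []            Y = refl
∣X⊠Y∣≡∣X∣*∣Y∣ {n = n} (outside ∷ X) Y =
  trans (∣p++q∣≡∣p∣+∣q∣ (∅ {n}) (X ⊠ Y)) (cong₂ _+_ (∣⊥∣≡0 n) (∣X⊠Y∣≡∣X∣*∣Y∣ X Y))
∣X⊠Y∣≡∣X∣*∣Y∣ (inside  ∷ X) Y =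
  trans (∣p++q∣≡∣p∣+∣q∣ Y (X ⊠ Y)) (cong (∣ Y ∣ +_) (∣X⊠Y∣≡∣X∣*∣Y∣ X Y))

combine∈⊠⁺ : ∀ {m n} {X : Subset m} {Y : Subset n} {a c} → a ∈ X → c ∈ Y → combine a c ∈ X ⊠ Y
combine∈⊠⁺                       here        c∈Y = ∈-++⁺ˡ c∈Y
combine∈⊠⁺ {X = outside ∷ X}     (there a∈X) c∈Y = ∈-++⁺ʳ ∅ (combine∈⊠⁺ a∈X c∈Y)
combine∈⊠⁺ {X = inside  ∷ X} {Y} (there a∈X) c∈Y = ∈-++⁺ʳ Y (combine∈⊠⁺ a∈X c∈Y)

combine∈⊠⁻ : ∀ {m n} (X : Subset m) (Y : Subset n) a c → combine a c ∈ X ⊠ Y → a ∈ X × c ∈ Y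
combine∈⊠⁻ (outside ∷ X) Y zero    c e = ⊥-elim (∉⊥ (∈-++⁻ˡ ∅ e))
combine∈⊠⁻ (inside  ∷ X) Y zero    c e = here , ∈-++⁻ˡ Y e
combine∈⊠⁻ (outside ∷ X) Y (suc a) c e = map₁ there (combine∈⊠⁻ X Y a c (∈-++⁻ʳ ∅ e))
combine∈⊠⁻ (inside  ∷ X) Y (suc a) c e = map₁ there (combine∈⊠⁻ X Y a c (∈-++⁻ʳ Y e))

module _ {m n : ℕ} where

  ∈⊠⁺ : ∀ {X : Subset m} {Y : Subset n} {i} →
    quotient {m} n i ∈ X → remainder {m} n i ∈ Y → i ∈ X ⊠ Y
  ∈⊠⁺ {X} {Y} {i} q∈X r∈Y = subst (_∈ X ⊠ Y) (combine-remQuot {m} n i) (combine∈⊠⁺ q∈X r∈Y)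

  ∈⊠⁻ : ∀ (X : Subset m) (Y : Subset n) {i} →
    i ∈ X ⊠ Y → quotient {m} n i ∈ X × remainder {m} n i ∈ Y
  ∈⊠⁻ X Y {i} i∈ = combine∈⊠⁻ X Y _ _ (subst (_∈ X ⊠ Y) (sym (combine-remQuot {m} n i)) i∈)

  ⊠-disjoint : ∀ {X X′ : Subset m} (Y Y′ : Subset n) → Disjoint X X′ → Disjoint (X ⊠ Y) (X′ ⊠ Y′)
  ⊠-disjoint {X} {X′} Y Y′ disjoint i∈ i∈′ =
    disjoint (proj₁ (∈⊠⁻ X Y i∈)) (proj₁ (∈⊠⁻ X′ Y′ i∈′))

  ∣diagonal∣ : ∀ {A B : Subset m} (C D : Subset n) → Disjoint A B →
    ∣ (A ⊠ C) ∪ (B ⊠ D) ∣ ≡ ∣ A ∣ * ∣ C ∣ + ∣ B ∣ * ∣ D ∣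
  ∣diagonal∣ {A} {B} C D disjoint =
    trans (∣p∪q∣≡∣p∣+∣q∣ (A ⊠ C) (B ⊠ D) (⊠-disjoint C D disjoint))
          (cong₂ _+_ (∣X⊠Y∣≡∣X∣*∣Y∣ A C) (∣X⊠Y∣≡∣X∣*∣Y∣ B D))

-- Independent and dominating sets in a graph G

module _ {k : ℕ} (G : Graph k) where

  NoEdges : Subset k → Subset k → Set
  NoEdges S T = ∀ {x y} → x ∈ S → y ∈ T → ¬ Adj G x y

  Dominating : Subset k → Set
  Dominating S = ∀ x → InClosedNbhd G S x

  inClosedNbhd? : ∀ S → Decidable (InClosedNbhd G S)
  inClosedNbhd? S x = (x ∈? S) ⊎-dec any? (λ z → (z ∈? S) ×-dec adj? G z x)

  closedNbhd-mono : ∀ {S T} → S ⊆ T → ∀ {x} → InClosedNbhd G S x → InClosedNbhd G T x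
  closedNbhd-mono S⊆T (inj₁ x∈S)              = inj₁ (S⊆T x∈S)
  closedNbhd-mono S⊆T (inj₂ (z , z∈S , z~x)) = inj₂ (z , S⊆T z∈S , z~x)

  independent-⊆ : ∀ {S T} → T ⊆ S → Independent G S → Independent G T
  independent-⊆ T⊆S indS x∈T y∈T = indS (T⊆S x∈T) (T⊆S y∈T)

  ∪-noEdges : ∀ {S S′ T} → NoEdges S T → NoEdges S′ T → NoEdges (S ∪ S′) T
  ∪-noEdges {S} {S′} none none′ x∈ y∈T =
    [ (λ x∈S → none x∈S y∈T) , (λ x∈S′ → none′ x∈S′ y∈T) ]′ (x∈p∪q⁻ S S′ x∈)

  ∪-independent : ∀ {S T} → Independent G S → Independent G T → NoEdges S T →
    Independent G (S ∪ T)
  ∪-independent {S} {T} indS indT none x∈ y∈ x~y with x∈p∪q⁻ S T x∈ | x∈p∪q⁻ S T y∈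
  ... | inj₁ x∈S | inj₁ y∈S = indS x∈S y∈S x~y
  ... | inj₁ x∈S | inj₂ y∈T = none x∈S y∈T x~y
  ... | inj₂ x∈T | inj₁ y∈S = none y∈S x∈T (symm G x~y)
  ... | inj₂ x∈T | inj₂ y∈T = indT x∈T y∈T x~y

  insert-independent : ∀ {S x} → Independent G S → ¬ InClosedNbhd G S x →
    Independent G (S ∪ ⁅ x ⁆)
  insert-independent {S} {x} indS x∉N[S] = ∪-independent indS singleton noEdge
    where
    singleton : Independent G ⁅ x ⁆
    singleton y∈ z∈ y~z with refl ← x∈⁅y⁆⇒x≡y x y∈ | refl ← x∈⁅y⁆⇒x≡y x z∈ = irrefl G y~z
    noEdge : NoEdges S ⁅ x ⁆
    noEdge {y} y∈S z∈ y~z with refl ← x∈⁅y⁆⇒x≡y x z∈ = x∉N[S] (inj₂ (y , y∈S , y~z))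

  maximal⇒dominating : ∀ {S} → MaximalIndependent G S → Dominating S
  maximal⇒dominating {S} (indS , maximal) x with inClosedNbhd? S x
  ... | yes x∈N[S] = x∈N[S]
  ... | no  x∉N[S] = ⊥-elim (x∉N[S] (inj₁ (maximal (S ∪ ⁅ x ⁆)
          (insert-independent indS x∉N[S]) (p⊆p∪q ⁅ x ⁆) (q⊆p∪q S ⁅ x ⁆ (x∈⁅x⁆ x)))))

  dominating⇒maximal : ∀ {S} → Independent G S → Dominating S → MaximalIndependent G S
  dominating⇒maximal {S} indS domS = indS , λ T indT S⊆T {x} x∈T → absorbed indT S⊆T x∈T (domS x)
    where
    absorbed : ∀ {T x} → Independent G T → S ⊆ T → x ∈ T → InClosedNbhd G S x → x ∈ S
    absorbed indT S⊆T x∈T (inj₁ x∈S)              = x∈S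
    absorbed indT S⊆T x∈T (inj₂ (z , z∈S , z~x)) = ⊥-elim (indT (S⊆T z∈S) x∈T z~x)

  maximalIndependent? : ∀ S → Dec (MaximalIndependent G S)
  maximalIndependent? S = map′ fromParts toParts (independent? ×-dec all? (inClosedNbhd? S))
    where
    fromParts : Independent G S × Dominating S → MaximalIndependent G S
    fromParts (indS , domS) = dominating⇒maximal indS domS
    toParts : MaximalIndependent G S → Independent G S × Dominating S
    toParts misS = proj₁ misS , maximal⇒dominating misS
    independent? : Dec (Independent G S)
    independent? =
      map′ (λ ind {x} {y} → ind x y) (λ ind x y → ind {x} {y})
           (all? λ x → all? λ y → (x ∈? S) →-dec ((y ∈? S) →-dec ¬? (adj? G x y)))

  record GreedyExtension (S W : Subset k) (xs : List (Fin k)) : Set where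
    field
      set         : Subset k
      independent : Independent G set
      extends     : S ⊆ set
      within      : set ⊆ S ∪ W
      dominates   : ∀ {x} → x ∈ₗ xs → x ∈ W → InClosedNbhd G set x

  greedy : ∀ S W → Independent G S → (xs : List (Fin k)) → GreedyExtension S W xs
  greedy S W indS [] = record
    { set = S ; independent = indS ; extends = λ x∈S → x∈S ; within = p⊆p∪q W ; dominates = λ () }
  greedy S W indS (x ∷ xs) with (x ∈? W) ×-dec ¬? (inClosedNbhd? S x)
  ... | yes (x∈W , x∉N[S]) = record
    { set         = set
    ; independent = independent
    ; extends     = λ y∈S → extends (p⊆p∪q ⁅ x ⁆ y∈S)
    ; within      = λ y∈ → absorb (within y∈)
    ; dominates   = λ { (here refl) _ → inj₁ (extends (q⊆p∪q S ⁅ x ⁆ (x∈⁅x⁆ x)))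
                      ; (there y∈xs) → dominates y∈xs }
    }
    where
    open GreedyExtension (greedy (S ∪ ⁅ x ⁆) W (insert-independent indS x∉N[S]) xs)
    absorb : ∀ {y} → y ∈ (S ∪ ⁅ x ⁆) ∪ W → y ∈ S ∪ W
    absorb {y} y∈ with x∈p∪q⁻ (S ∪ ⁅ x ⁆) W y∈
    ... | inj₂ y∈W = q⊆p∪q S W y∈W
    ... | inj₁ y∈S+x with x∈p∪q⁻ S ⁅ x ⁆ y∈S+x
    ...   | inj₁ y∈S = p⊆p∪q W y∈S
    ...   | inj₂ y∈⁅x⁆ with refl ← x∈⁅y⁆⇒x≡y x y∈⁅x⁆ = q⊆p∪q S W x∈W
  ... | no ¬free = record
    { set         = set
    ; independent = independent
    ; extends     = extends
    ; within      = within
    ; dominates   = λ { (here refl) x∈W → closedNbhd-mono extends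
                          (decidable-stable (inClosedNbhd? S x) (λ x∉N[S] → ¬free (x∈W , x∉N[S])))
                      ; (there y∈xs) → dominates y∈xs }
    }
    where open GreedyExtension (greedy S W indS xs)

  extendToMaximal : ∀ S → Independent G S → ∃ λ S′ → MaximalIndependent G S′ × S ⊆ S′
  extendToMaximal S indS =
    set , dominating⇒maximal independent (λ x → dominates (∈-allFin x) ∈⊤) , extends
    where open GreedyExtension (greedy S ⊤ indS (allFin k))

  -- Part (i).  Suppose N dominates every vertex outside the independent set M but not u ∈ M.
  -- Then the independent set N ∪ {y ∈ M ∖ N[N] : y ≠ u} dominates every vertex except u.
  isolatable-of-gap : ∀ {M N u} → Independent G M → Independent G N →
    (∀ x → x ∉ M → InClosedNbhd G N x) → u ∈ M → ¬ InClosedNbhd G N u → Isolatable G u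
  isolatable-of-gap {M} {N} {u} indM indN domN u∈M u∉N[N] =
    N ∪ Rest , ∪-independent indN indRest noEdges , λ y → mk⇔ (onlyU y) (λ { refl → undominated })
    where
    RestP : Fin k → Set
    RestP y = y ∈ M × ¬ InClosedNbhd G N y × y ≢ u
    rest? : Decidable RestP
    rest? y = (y ∈? M) ×-dec ¬? (inClosedNbhd? N y) ×-dec ¬? (y ≟ u)
    Rest : Subset k
    Rest = ⟦ rest? ⟧
    indRest : Independent G Rest
    indRest = independent-⊆ (λ y∈ → proj₁ (∈⟦⟧⁻ rest? y∈)) indM
    noEdges : NoEdges N Rest
    noEdges {x} x∈N y∈ x~y = proj₁ (proj₂ (∈⟦⟧⁻ rest? y∈)) (inj₂ (x , x∈N , x~y))
    onlyU : ∀ y → ¬ InClosedNbhd G (N ∪ Rest) y → y ≡ u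
    onlyU y y∉ with y ≟ u | inClosedNbhd? N y
    ... | yes y≡u | _          = y≡u
    ... | no _    | yes y∈N[N] = ⊥-elim (y∉ (closedNbhd-mono (p⊆p∪q Rest) y∈N[N]))
    ... | no y≢u  | no y∉N[N]  = ⊥-elim (y∉ (inj₁ (q⊆p∪q N Rest (∈⟦⟧⁺ rest? (y∈M , y∉N[N] , y≢u)))))
      where
      y∈M : y ∈ M
      y∈M = decidable-stable (y ∈? M) (λ y∉M → y∉N[N] (domN y y∉M))
    undominated : ¬ InClosedNbhd G (N ∪ Rest) u
    undominated (inj₁ u∈) with x∈p∪q⁻ N Rest u∈
    ... | inj₁ u∈N    = u∉N[N] (inj₁ u∈N)
    ... | inj₂ u∈Rest = proj₂ (proj₂ (∈⟦⟧⁻ rest? u∈Rest)) refl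
    undominated (inj₂ (z , z∈ , z~u)) with x∈p∪q⁻ N Rest z∈
    ... | inj₁ z∈N    = u∉N[N] (inj₂ (z , z∈N , z~u))
    ... | inj₂ z∈Rest = indM (proj₁ (∈⟦⟧⁻ rest? z∈Rest)) u∈M z~u

  -- A maximal independent set N of the vertices outside M dominates G, since otherwise a
  -- vertex of M would be isolatable; N is then a maximal independent set disjoint from M.
  disjointMaximal : ¬ HasIsolatableVertex G → DisjointMISProperty G
  disjointMaximal noIsolatable M misM =
    N , dominating⇒maximal indN domN , Disjoint⇒Empty∩ N∩M=∅
    where
    open GreedyExtension (greedy ∅ (∁ M) (λ x∈∅ _ _ → ∉⊥ x∈∅) (allFin k))
      renaming (set to N; independent to indN)
    outsideM : ∀ x → x ∉ M → InClosedNbhd G N x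
    outsideM x x∉M = dominates (∈-allFin x) (x∉p⇒x∈∁p x∉M)
    domN : Dominating N
    domN x with inClosedNbhd? N x
    ... | yes x∈N[N] = x∈N[N]
    ... | no  x∉N[N] =
      ⊥-elim (noIsolatable (x , isolatable-of-gap (proj₁ misM) indN outsideM x∈M x∉N[N]))
      where
      x∈M : x ∈ M
      x∈M = decidable-stable (x ∈? M) (λ x∉M → x∉N[N] (outsideM x x∉M))
    N∩M=∅ : Disjoint N M
    N∩M=∅ x∈N x∈M = [ ∉⊥ , (λ x∈∁M → x∈∁p⇒x∉p x∈∁M x∈M) ]′ (x∈p∪q⁻ ∅ (∁ M) (within x∈N))

  record Surrounds (S R : Subset k) : Set where
    field
      independent      : Independent G S
      dominatesOutside : ∀ x → x ∉ R → InClosedNbhd G S x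
      disjoint         : Disjoint S R
      noEdges          : NoEdges S R

  -- Extend S₁ to a maximal independent set S₁′ = S₁ ∪ T with T = S₁′ ∩ R; then S₂ ∪ T is a
  -- maximal independent set too, so ∣S₁∣ + ∣T∣ = ∣S₂∣ + ∣T∣.
  exchange : WellCovered G → ∀ {S₁ S₂ R} → Surrounds S₁ R → Surrounds S₂ R → ∣ S₁ ∣ ≡ ∣ S₂ ∣
  exchange wellCovered {S₁} {S₂} {R} sur₁ sur₂ = +-cancelʳ-≡ (∣ T ∣) (∣ S₁ ∣) (∣ S₂ ∣) (begin
    ∣ S₁ ∣ + ∣ T ∣  ≡⟨ sym (∣p∪q∣≡∣p∣+∣q∣ S₁ T (λ x∈S₁ x∈T → Sur₁.disjoint x∈S₁ (T⊆R x∈T))) ⟩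
    ∣ S₁ ∪ T ∣     ≡⟨ cong ∣_∣ (⊆-antisym S₁∪T⊆S₁′ S₁′⊆S₁∪T) ⟩
    ∣ S₁′ ∣        ≡⟨ wellCovered S₁′ (S₂ ∪ T) misS₁′ misS₂∪T ⟩
    ∣ S₂ ∪ T ∣     ≡⟨ ∣p∪q∣≡∣p∣+∣q∣ S₂ T (λ x∈S₂ x∈T → Sur₂.disjoint x∈S₂ (T⊆R x∈T)) ⟩
    ∣ S₂ ∣ + ∣ T ∣  ∎)
    where
    module Sur₁ = Surrounds sur₁
    module Sur₂ = Surrounds sur₂
    S₁′ : Subset k
    S₁′ = proj₁ (extendToMaximal S₁ Sur₁.independent)
    misS₁′ : MaximalIndependent G S₁′
    misS₁′ = proj₁ (proj₂ (extendToMaximal S₁ Sur₁.independent))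
    S₁⊆S₁′ : S₁ ⊆ S₁′
    S₁⊆S₁′ = proj₂ (proj₂ (extendToMaximal S₁ Sur₁.independent))
    T : Subset k
    T = S₁′ ∩ R
    T⊆R : T ⊆ R
    T⊆R = p∩q⊆q S₁′ R
    S₁∪T⊆S₁′ : S₁ ∪ T ⊆ S₁′
    S₁∪T⊆S₁′ x∈ = [ S₁⊆S₁′ , p∩q⊆p S₁′ R ]′ (x∈p∪q⁻ S₁ T x∈)
    -- a vertex of S₁′ outside R is dominated by S₁ ⊆ S₁′, hence lies in S₁
    S₁′⊆S₁∪T : S₁′ ⊆ S₁ ∪ T
    S₁′⊆S₁∪T {x} x∈S₁′ with x ∈? R
    ... | yes x∈R = q⊆p∪q S₁ T (x∈p∩q⁺ (x∈S₁′ , x∈R))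
    ... | no  x∉R with Sur₁.dominatesOutside x x∉R
    ...   | inj₁ x∈S₁              = p⊆p∪q T x∈S₁
    ...   | inj₂ (z , z∈S₁ , z~x) = ⊥-elim (proj₁ misS₁′ (S₁⊆S₁′ z∈S₁) x∈S₁′ z~x)
    -- a vertex of R is dominated by S₁′, and not through S₁, hence through T
    dominatesR : ∀ x → x ∈ R → InClosedNbhd G T x
    dominatesR x x∈R with maximal⇒dominating misS₁′ x
    ... | inj₁ x∈S₁′ = inj₁ (x∈p∩q⁺ (x∈S₁′ , x∈R))
    ... | inj₂ (z , z∈S₁′ , z~x) with x∈p∪q⁻ S₁ T (S₁′⊆S₁∪T z∈S₁′)
    ...   | inj₁ z∈S₁ = ⊥-elim (Sur₁.noEdges z∈S₁ x∈R z~x)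
    ...   | inj₂ z∈T  = inj₂ (z , z∈T , z~x)
    domS₂∪T : Dominating (S₂ ∪ T)
    domS₂∪T x with x ∈? R
    ... | yes x∈R = closedNbhd-mono (q⊆p∪q S₂ T) (dominatesR x x∈R)
    ... | no  x∉R = closedNbhd-mono (p⊆p∪q T) (Sur₂.dominatesOutside x x∉R)
    misS₂∪T : MaximalIndependent G (S₂ ∪ T)
    misS₂∪T = dominating⇒maximal
      (∪-independent Sur₂.independent (independent-⊆ (p∩q⊆p S₁′ R) (proj₁ misS₁′))
                     (λ x∈S₂ y∈T → Sur₂.noEdges x∈S₂ (T⊆R y∈T)))
      domS₂∪T

-- The Cartesian product G □ H; a vertex i has coordinates quotient i ∈ G and remainder i ∈ H.

module _ {m n : ℕ} (G : Graph m) (H : Graph n) where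

  private
    q : Fin (m * n) → Fin m
    q = quotient {m} n
    r : Fin (m * n) → Fin n
    r = remainder {m} n

  liftˡ : ∀ {a i} → Adj G a (q i) → Adj (G □ H) (combine a (r i)) i
  liftˡ {a} {i} a~qi =
    inj₂ (subst (λ b → Adj G b (q i)) (sym (cong proj₁ coords)) a~qi , cong proj₂ coords)
    where
    coords : remQuot n (combine a (r i)) ≡ (a , r i)
    coords = remQuot-combine a (r i)

  liftʳ : ∀ {c i} → Adj H c (r i) → Adj (G □ H) (combine (q i) c) i
  liftʳ {c} {i} c~ri =
    inj₁ (cong proj₁ coords , subst (λ d → Adj H d (r i)) (sym (cong proj₂ coords)) c~ri)
    where
    coords : remQuot n (combine (q i) c) ≡ (q i , c)
    coords = remQuot-combine (q i) c

  ⊠-dominatedˡ : ∀ {X Y i} → InClosedNbhd G X (q i) → r i ∈ Y → InClosedNbhd (G □ H) (X ⊠ Y) i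
  ⊠-dominatedˡ (inj₁ qi∈X)              ri∈Y = inj₁ (∈⊠⁺ qi∈X ri∈Y)
  ⊠-dominatedˡ (inj₂ (a , a∈X , a~qi)) ri∈Y = inj₂ (_ , combine∈⊠⁺ a∈X ri∈Y , liftˡ a~qi)

  ⊠-dominatedʳ : ∀ {X Y i} → q i ∈ X → InClosedNbhd H Y (r i) → InClosedNbhd (G □ H) (X ⊠ Y) i
  ⊠-dominatedʳ qi∈X (inj₁ ri∈Y)              = inj₁ (∈⊠⁺ qi∈X ri∈Y)
  ⊠-dominatedʳ qi∈X (inj₂ (c , c∈Y , c~ri)) = inj₂ (_ , combine∈⊠⁺ qi∈X c∈Y , liftʳ c~ri)

  ⊠-independent : ∀ {X Y} → Independent G X → Independent H Y → Independent (G □ H) (X ⊠ Y)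
  ⊠-independent {X} {Y} indX indY i∈ j∈ (inj₁ (_ , ri~rj)) =
    indY (proj₂ (∈⊠⁻ X Y i∈)) (proj₂ (∈⊠⁻ X Y j∈)) ri~rj
  ⊠-independent {X} {Y} indX indY i∈ j∈ (inj₂ (qi~qj , _)) =
    indX (proj₁ (∈⊠⁻ X Y i∈)) (proj₁ (∈⊠⁻ X Y j∈)) qi~qj

  -- An edge of G □ H keeps one coordinate fixed, so products of pairwise disjoint factors
  -- are not joined by edges.
  ⊠-noEdges : ∀ {X X′ Y Y′} → Disjoint X X′ → Disjoint Y Y′ → NoEdges (G □ H) (X ⊠ Y) (X′ ⊠ Y′)
  ⊠-noEdges {X} {X′} {Y} {Y′} disjointX _ i∈ j∈ (inj₁ (qi≡qj , _)) =
    disjointX (subst (_∈ X) qi≡qj (proj₁ (∈⊠⁻ X Y i∈))) (proj₁ (∈⊠⁻ X′ Y′ j∈))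
  ⊠-noEdges {X} {X′} {Y} {Y′} _ disjointY i∈ j∈ (inj₂ (_ , ri≡rj)) =
    disjointY (subst (_∈ Y) ri≡rj (proj₂ (∈⊠⁻ X Y i∈))) (proj₂ (∈⊠⁻ X′ Y′ j∈))

  diagonal-surrounds : ∀ {A B C D} →
    MaximalIndependent G A → MaximalIndependent G B → Disjoint A B →
    MaximalIndependent H C → MaximalIndependent H D → Disjoint C D →
    Surrounds (G □ H) ((A ⊠ C) ∪ (B ⊠ D)) (∁ (A ∪ B) ⊠ ∁ (C ∪ D))
  diagonal-surrounds {A} {B} {C} {D} misA misB A∩B=∅ misC misD C∩D=∅ = record
    { independent      = ∪-independent (G □ H) (⊠-independent (proj₁ misA) (proj₁ misC))
                           (⊠-independent (proj₁ misB) (proj₁ misD)) (⊠-noEdges A∩B=∅ C∩D=∅)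
    ; dominatesOutside = dominated
    ; disjoint         = ∪-disjoint (⊠-disjoint C (∁ (C ∪ D)) (disjoint-∁∪ˡ A B))
                                    (⊠-disjoint D (∁ (C ∪ D)) (disjoint-∁∪ʳ A B))
    ; noEdges          = ∪-noEdges (G □ H) (⊠-noEdges (disjoint-∁∪ˡ A B) (disjoint-∁∪ˡ C D))
                                           (⊠-noEdges (disjoint-∁∪ʳ A B) (disjoint-∁∪ʳ C D))
    }
    where
    viaAC : ∀ {i} → InClosedNbhd (G □ H) (A ⊠ C) i → InClosedNbhd (G □ H) ((A ⊠ C) ∪ (B ⊠ D)) i
    viaAC = closedNbhd-mono (G □ H) (p⊆p∪q (B ⊠ D))
    viaBD : ∀ {i} → InClosedNbhd (G □ H) (B ⊠ D) i → InClosedNbhd (G □ H) ((A ⊠ C) ∪ (B ⊠ D)) i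
    viaBD = closedNbhd-mono (G □ H) (q⊆p∪q (A ⊠ C) (B ⊠ D))
    dominated : ∀ i → i ∉ ∁ (A ∪ B) ⊠ ∁ (C ∪ D) → InClosedNbhd (G □ H) ((A ⊠ C) ∪ (B ⊠ D)) i
    dominated i i∉R with q i ∈? A | q i ∈? B | r i ∈? C | r i ∈? D
    ... | yes qi∈A | _        | _        | _        =
      viaAC (⊠-dominatedʳ qi∈A (maximal⇒dominating H misC (r i)))
    ... | no _     | yes qi∈B | _        | _        =
      viaBD (⊠-dominatedʳ qi∈B (maximal⇒dominating H misD (r i)))
    ... | no _     | no _     | yes ri∈C | _        =
      viaAC (⊠-dominatedˡ (maximal⇒dominating G misA (q i)) ri∈C)
    ... | no _     | no _     | no _     | yes ri∈D =
      viaBD (⊠-dominatedˡ (maximal⇒dominating G misB (q i)) ri∈D)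
    ... | no qi∉A  | no qi∉B  | no ri∉C  | no ri∉D  =
      ⊥-elim (i∉R (∈⊠⁺ (∉∪⇒∈∁∪ qi∉A qi∉B) (∉∪⇒∈∁∪ ri∉C ri∉D)))

-- ∣A∣∣C∣ + ∣B∣∣D∣ = ∣A∣∣D∣ + ∣B∣∣C∣ says (a − b)(c − d) = 0.
cross-products-equal : ∀ a b c d → a * c + b * d ≡ a * d + b * c → a ≡ b ⊎ c ≡ d
cross-products-equal zero    zero    c d _  = inj₁ refl
cross-products-equal zero    (suc b) c d eq = inj₂ (sym (*-cancelˡ-≡ d c (suc b) eq))
cross-products-equal (suc a) zero    c d eq =
  inj₂ (*-cancelˡ-≡ c d (suc a) (trans (sym (+-identityʳ _)) (trans eq (+-identityʳ _))))
cross-products-equal (suc a) (suc b) c d eq =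
  Sum.map₁ (cong suc) (cross-products-equal a b c d (+-cancelˡ-≡ (c + d) _ _ (begin
    (c + d) + (a * c + b * d)  ≡⟨ interchange +-commutativeSemigroup c d (a * c) (b * d) ⟩
    suc a * c + suc b * d      ≡⟨ eq ⟩
    suc a * d + suc b * c      ≡⟨ interchange +-commutativeSemigroup d (a * d) c (b * c) ⟩
    (d + c) + (a * d + b * c)  ≡⟨ cong (_+ (a * d + b * c)) (+-comm d c) ⟩
    (c + d) + (a * d + b * c)  ∎)))

-- In a well-covered G □ H, a pair of disjoint maximal independent sets is balanced in G or in H:
-- both diagonal sets surround the same region, so the exchange lemma equates their sizes.
balanced-in-a-factor : ∀ {m n} (G : Graph m) (H : Graph n) → WellCovered (G □ H) →
  ∀ {A B C D} → MaximalIndependent G A → MaximalIndependent G B → Disjoint A B →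
  MaximalIndependent H C → MaximalIndependent H D → Disjoint C D → ∣ A ∣ ≡ ∣ B ∣ ⊎ ∣ C ∣ ≡ ∣ D ∣
balanced-in-a-factor G H wellCovered {A} {B} {C} {D} misA misB A∩B=∅ misC misD C∩D=∅ =
  cross-products-equal (∣ A ∣) (∣ B ∣) (∣ C ∣) (∣ D ∣) (begin
    ∣ A ∣ * ∣ C ∣ + ∣ B ∣ * ∣ D ∣  ≡⟨ sym (∣diagonal∣ C D A∩B=∅) ⟩
    ∣ (A ⊠ C) ∪ (B ⊠ D) ∣        ≡⟨ exchange (G □ H) wellCovered surroundsCD surroundsDC ⟩
    ∣ (A ⊠ D) ∪ (B ⊠ C) ∣        ≡⟨ ∣diagonal∣ D C A∩B=∅ ⟩
    ∣ A ∣ * ∣ D ∣ + ∣ B ∣ * ∣ C ∣  ∎)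
  where
  R : Subset _
  R = ∁ (A ∪ B) ⊠ ∁ (C ∪ D)
  surroundsCD : Surrounds (G □ H) ((A ⊠ C) ∪ (B ⊠ D)) R
  surroundsCD = diagonal-surrounds G H misA misB A∩B=∅ misC misD C∩D=∅
  surroundsDC : Surrounds (G □ H) ((A ⊠ D) ∪ (B ⊠ C)) R
  surroundsDC = subst (Surrounds (G □ H) ((A ⊠ D) ∪ (B ⊠ C)))
                      (cong (λ E → ∁ (A ∪ B) ⊠ ∁ E) (∪-comm D C))
                      (diagonal-surrounds G H misA misB A∩B=∅ misD misC (λ x∈D x∈C → C∩D=∅ x∈C x∈D))

-- Since maximality, disjointness and size are decidable, either all disjoint pairs of maximal
-- independent sets are balanced or there is an unbalanced one.
UnbalancedPair : ∀ {k} → Graph k → Subset k → Subset k → Set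
UnbalancedPair G M N =
  MaximalIndependent G M × MaximalIndependent G N × Empty (M ∩ N) × ∣ M ∣ ≢ ∣ N ∣

unbalancedPair? : ∀ {k} (G : Graph k) → Dec (∃₂ (UnbalancedPair G))
unbalancedPair? G = anySubset? λ M → anySubset? λ N →
  maximalIndependent? G M ×-dec maximalIndependent? G N ×-dec
  ¬? (nonempty? (M ∩ N)) ×-dec ¬? (∣ M ∣ ≟ℕ ∣ N ∣)

balanced-or-unbalancedPair : ∀ {k} (G : Graph k) → DisjointMISEqualSize G ⊎ ∃₂ (UnbalancedPair G)
balanced-or-unbalancedPair G with unbalancedPair? G
... | yes (M , N , unbalanced) = inj₂ (M , N , unbalanced)
... | no  noUnbalanced = inj₁ λ M N misM misN M∩N=∅ →
  decidable-stable (∣ M ∣ ≟ℕ ∣ N ∣) (λ M≢N → noUnbalanced (M , N , misM , misN , M∩N=∅ , M≢N))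

lemma5 : {m n : ℕ} (G : Graph m) (H : Graph n) →
    ¬ HasIsolatableVertex G → ¬ HasIsolatableVertex H →
    WellCovered (G □ H) →
    (DisjointMISProperty G × DisjointMISProperty H) ×
    (DisjointMISEqualSize G ⊎ DisjointMISEqualSize H)
lemma5 G H noIsolatableG noIsolatableH wellCovered =
  (disjointMaximal G noIsolatableG , disjointMaximal H noIsolatableH) , someFactorBalanced
  where
  someFactorBalanced : DisjointMISEqualSize G ⊎ DisjointMISEqualSize H
  someFactorBalanced with balanced-or-unbalancedPair G | balanced-or-unbalancedPair H
  ... | inj₁ balancedG | _             = inj₁ balancedG
  ... | inj₂ _         | inj₁ balancedH = inj₂ balancedH
  ... | inj₂ (A , B , misA , misB , A∩B=∅ , A≢B) | inj₂ (C , D , misC , misD , C∩D=∅ , C≢D) =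
    ⊥-elim ([ A≢B , C≢D ]′ (balanced-in-a-factor G H wellCovered
      misA misB (Empty∩⇒Disjoint A∩B=∅) misC misD (Empty∩⇒Disjoint C∩D=∅)))
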